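{- Let $M$ be a matroid on a finite set $E$ with $r(M)>0$. If $M$ is a unique expansion matroid, then its dual $M^*$ is a unique exchange matroid.
   Context: $\mathcal{B}(N)$ is the family of bases of a matroid $N$; $r(M)$ is the common cardinality of bases of $M$. $s(M)=\{A \text{ independent in } M: |A|=r(M)-1\}$. $M$ is a unique expansion matroid if for every $B\in\mathcal{B}(M)$ and every $A\in s(M)$, whenever $e_1,e_2\in B$ satisfy $A\cup\{e_1\},A\cup\{e_2\}\in\mathcal{B}(M)$, then $e_1=e_2$. The dual $M^*$ is the matroid on $E$ with bases $\{E-B: B\in\mathcal{B}(M)\}$. A matroid $N$ is a unique exchange matroid if for all $B_1,B_2\in\mathcal{B}(N)$, whenever $x\in B_1-B_2$, $y_1,y_2\in B_2-B_1$, $(B_1-\{x\})\cup\{y_1\}\in\mathcal{B}(N)$ and $(B_1-\{x\})\cup\{y_2\}\in\mathcal{B}(N)$, then $y_1=y_2$. -}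

module Defs where

open import Data.Nat using (ℕ; suc; _<_)
open import Data.Fin using (Fin)
open import Data.Fin.Subset using (Subset; _∈_; _∉_; _⊆_; _∪_; _-_; _─_; ⁅_⁆; ⊤; ∣_∣)
open import Data.Product using (Σ; ∃; _×_; _,_)
open import Relation.Binary.PropositionalEquality using (_≡_)

record Matroid (n : ℕ) : Set₁ where
  field
    IsBase   : Subset n → Set
    base-∃   : ∃ λ B → IsBase B
    exchange : ∀ B₁ B₂ x → IsBase B₁ → IsBase B₂ → x ∈ B₁ → x ∉ B₂ →
               ∃ λ y → y ∈ B₂ × y ∉ B₁ × IsBase ((B₁ - x) ∪ ⁅ y ⁆)

open Matroid public

module _ {n : ℕ} where

  Independent : Matroid n → Subset n → Set
  Independent M A = ∃ λ B → IsBase M B × A ⊆ B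

  HasRank : Matroid n → ℕ → Set
  HasRank M k = ∀ B → IsBase M B → ∣ B ∣ ≡ k

  InS : Matroid n → Subset n → Set
  InS M A = Independent M A × (∀ B → IsBase M B → suc ∣ A ∣ ≡ ∣ B ∣)

  UniqueExpansion : Matroid n → Set
  UniqueExpansion M =
    ∀ B A e₁ e₂ → IsBase M B → InS M A → e₁ ∈ B → e₂ ∈ B →
    IsBase M (A ∪ ⁅ e₁ ⁆) → IsBase M (A ∪ ⁅ e₂ ⁆) → e₁ ≡ e₂

  DualBase : Matroid n → Subset n → Set
  DualBase M X = ∃ λ B → IsBase M B × X ≡ ⊤ ─ B

  UniqueExchange : (Subset n → Set) → Set
  UniqueExchange IsB =
    ∀ B₁ B₂ x y₁ y₂ → IsB B₁ → IsB B₂ →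
    x ∈ B₁ → x ∉ B₂ → y₁ ∈ B₂ → y₁ ∉ B₁ → y₂ ∈ B₂ → y₂ ∉ B₁ →
    IsB ((B₁ - x) ∪ ⁅ y₁ ⁆) → IsB ((B₁ - x) ∪ ⁅ y₂ ⁆) → y₁ ≡ y₂

-- If B₁ = E − C is a base of M* and (B₁ − x) ∪ {y} = E − D, then by de Morgan
-- D = (C ∪ {x}) − y. So two dual exchanges at x ∈ B₁ with distinct y₁, y₂ ∈ C give
-- the bases (C ∪ {x}) − y₁ and (C ∪ {x}) − y₂ of M; both expand the set
-- A = (C ∪ {x}) − y₁ − y₂ ∈ s(M), by y₂ and by y₁, two distinct elements of the
-- base C, which unique expansion forbids.
module Submission where

open import Defs
open import Data.Nat using (ℕ; _<_; suc)
open import Data.Fin using (Fin; zero; suc)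
open import Data.Fin.Properties using (_≟_)
open import Data.Fin.Subset using (Subset; _∈_; _∉_; _⊆_; _∪_; _-_; _─_; ⁅_⁆; ⊤; ∣_∣; inside; outside)
open import Data.Fin.Subset.Properties using (p─⊥≡p; p⊆p∪q; p─q⊆p; p─x─y≡p─y─x; x∈p∧x≢y⇒x∈p-y; ∪-identityʳ)
open import Data.Bool.Properties using (∨-identityʳ)
open import Data.Vec using (_∷_; []; here; there)
open import Data.Vec.Properties using (∷-injectiveʳ)
open import Data.Product using (_,_)
open import Function using (_∘_)
open import Relation.Nullary using (yes; no; contradiction)
open import Relation.Binary.PropositionalEquality using (_≡_; refl; sym; trans; subst; cong; cong₂; module ≡-Reasoning)

private variable n : ℕ

⊤─-injective : {p q : Subset n} → ⊤ ─ p ≡ ⊤ ─ q → p ≡ q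
⊤─-injective {p = []}          {[]}          _ = refl
⊤─-injective {p = inside ∷ p}  {inside ∷ q}  e = cong (inside ∷_) (⊤─-injective (∷-injectiveʳ e))
⊤─-injective {p = outside ∷ p} {outside ∷ q} e = cong (outside ∷_) (⊤─-injective (∷-injectiveʳ e))

x∉⊤─p⇒x∈p : {x : Fin n} {p : Subset n} → x ∉ ⊤ ─ p → x ∈ p
x∉⊤─p⇒x∈p {x = zero}  {inside ∷ p}  _   = here
x∉⊤─p⇒x∈p {x = zero}  {outside ∷ p} x∉  = contradiction here x∉
x∉⊤─p⇒x∈p {x = suc x} {_ ∷ p}       x∉  = there (x∉⊤─p⇒x∈p (x∉ ∘ there))

⊤─p─q∪r≡⊤─[p∪q─r] : (p q r : Subset n) → (⊤ ─ p ─ q) ∪ r ≡ ⊤ ─ (p ∪ q ─ r)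
⊤─p─q∪r≡⊤─[p∪q─r] []            []            []            = refl
⊤─p─q∪r≡⊤─[p∪q─r] (inside  ∷ p) (inside  ∷ q) (inside  ∷ r) = cong (_ ∷_) (⊤─p─q∪r≡⊤─[p∪q─r] p q r)
⊤─p─q∪r≡⊤─[p∪q─r] (inside  ∷ p) (inside  ∷ q) (outside ∷ r) = cong (_ ∷_) (⊤─p─q∪r≡⊤─[p∪q─r] p q r)
⊤─p─q∪r≡⊤─[p∪q─r] (inside  ∷ p) (outside ∷ q) (inside  ∷ r) = cong (_ ∷_) (⊤─p─q∪r≡⊤─[p∪q─r] p q r)
⊤─p─q∪r≡⊤─[p∪q─r] (inside  ∷ p) (outside ∷ q) (outside ∷ r) = cong (_ ∷_) (⊤─p─q∪r≡⊤─[p∪q─r] p q r)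
⊤─p─q∪r≡⊤─[p∪q─r] (outside ∷ p) (inside  ∷ q) (inside  ∷ r) = cong (_ ∷_) (⊤─p─q∪r≡⊤─[p∪q─r] p q r)
⊤─p─q∪r≡⊤─[p∪q─r] (outside ∷ p) (inside  ∷ q) (outside ∷ r) = cong (_ ∷_) (⊤─p─q∪r≡⊤─[p∪q─r] p q r)
⊤─p─q∪r≡⊤─[p∪q─r] (outside ∷ p) (outside ∷ q) (inside  ∷ r) = cong (_ ∷_) (⊤─p─q∪r≡⊤─[p∪q─r] p q r)
⊤─p─q∪r≡⊤─[p∪q─r] (outside ∷ p) (outside ∷ q) (outside ∷ r) = cong (_ ∷_) (⊤─p─q∪r≡⊤─[p∪q─r] p q r)

p-x∪⁅x⁆≡p : {x : Fin n} {p : Subset n} → x ∈ p → (p - x) ∪ ⁅ x ⁆ ≡ p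
p-x∪⁅x⁆≡p {p = inside ∷ p} here = cong (inside ∷_) (trans (∪-identityʳ (p ─ _)) (p─⊥≡p p))
p-x∪⁅x⁆≡p {p = s ∷ p} (there x∈p) = cong₂ _∷_ (∨-identityʳ s) (p-x∪⁅x⁆≡p x∈p)

suc∣p-x∣≡∣p∣ : {x : Fin n} {p : Subset n} → x ∈ p → suc ∣ p - x ∣ ≡ ∣ p ∣
suc∣p-x∣≡∣p∣ {p = inside ∷ p}  here        = cong (suc ∘ ∣_∣) (p─⊥≡p p)
suc∣p-x∣≡∣p∣ {p = inside ∷ p}  (there x∈p) = cong suc (suc∣p-x∣≡∣p∣ x∈p)
suc∣p-x∣≡∣p∣ {p = outside ∷ p} (there x∈p) = suc∣p-x∣≡∣p∣ x∈p

module _ (M : Matroid n) where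

  dualBase-exchange⇒base : {C : Subset n} {x y : Fin n} →
    DualBase M ((⊤ ─ C - x) ∪ ⁅ y ⁆) → IsBase M (C ∪ ⁅ x ⁆ - y)
  dualBase-exchange⇒base {C} {x} {y} (D , D-base , e) =
    subst (IsBase M) (⊤─-injective (trans (sym e) (⊤─p─q∪r≡⊤─[p∪q─r] C ⁅ x ⁆ ⁅ y ⁆))) D-base

  base-x∈s : {r : ℕ} {D : Subset n} {x : Fin n} →
    HasRank M r → IsBase M D → x ∈ D → InS M (D - x)
  base-x∈s {D = D} {x} rank D-base x∈D =
    (D , D-base , p─q⊆p D ⁅ x ⁆) ,
    λ B B-base → trans (suc∣p-x∣≡∣p∣ x∈D) (trans (rank D D-base) (sym (rank B B-base)))

  uniqueExpansion⇒removal-unique : {r : ℕ} {C P : Subset n} {y₁ y₂ : Fin n} →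
    UniqueExpansion M → HasRank M r → IsBase M C → C ⊆ P → y₁ ∈ C → y₂ ∈ C →
    IsBase M (P - y₁) → IsBase M (P - y₂) → y₁ ≡ y₂
  uniqueExpansion⇒removal-unique {P = P} {y₁} {y₂}
    unique rank C-base C⊆P y₁∈C y₂∈C P-y₁-base P-y₂-base with y₁ ≟ y₂
  ... | yes y₁≡y₂ = y₁≡y₂
  ... | no  y₁≢y₂ =
    contradiction (unique _ A y₁ y₂ C-base A∈s y₁∈C y₂∈C A∪⁅y₁⁆-base A∪⁅y₂⁆-base) y₁≢y₂
    where
    A : Subset n
    A = P - y₂ - y₁

    y₁∈P-y₂ : y₁ ∈ P - y₂
    y₁∈P-y₂ = x∈p∧x≢y⇒x∈p-y (C⊆P y₁∈C) y₁≢y₂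

    A∈s : InS M A
    A∈s = base-x∈s rank P-y₂-base y₁∈P-y₂

    A∪⁅y₁⁆-base : IsBase M (A ∪ ⁅ y₁ ⁆)
    A∪⁅y₁⁆-base = subst (IsBase M) (sym (p-x∪⁅x⁆≡p y₁∈P-y₂)) P-y₂-base

    A∪⁅y₂⁆≡P-y₁ : A ∪ ⁅ y₂ ⁆ ≡ P - y₁
    A∪⁅y₂⁆≡P-y₁ = begin
      (P - y₂ - y₁) ∪ ⁅ y₂ ⁆ ≡⟨ cong (_∪ ⁅ y₂ ⁆) (p─x─y≡p─y─x P y₂ y₁) ⟩
      (P - y₁ - y₂) ∪ ⁅ y₂ ⁆ ≡⟨ p-x∪⁅x⁆≡p (x∈p∧x≢y⇒x∈p-y (C⊆P y₂∈C) (y₁≢y₂ ∘ sym)) ⟩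
      P - y₁                 ∎
      where open ≡-Reasoning

    A∪⁅y₂⁆-base : IsBase M (A ∪ ⁅ y₂ ⁆)
    A∪⁅y₂⁆-base = subst (IsBase M) (sym A∪⁅y₂⁆≡P-y₁) P-y₁-base

theorem11 : (n : ℕ) (M : Matroid n) (r : ℕ) → HasRank M r → 0 < r →
    UniqueExpansion M → UniqueExchange (DualBase M)
theorem11 n M r rank _ unique .(⊤ ─ C) _ x y₁ y₂ (C , C-base , refl) _ _ _ _ y₁∉B₁ _ y₂∉B₁ e₁ e₂ =
  uniqueExpansion⇒removal-unique M unique rank C-base (p⊆p∪q ⁅ x ⁆)
    (x∉⊤─p⇒x∈p y₁∉B₁) (x∉⊤─p⇒x∈p y₂∉B₁)
    (dualBase-exchange⇒base M e₁) (dualBase-exchange⇒base M e₂)
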